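{- There is a polynomial $p$ such that for every $n\ge 2$ the formula $\textsc{QUParity}_n$ has an $\mathrm{OBDD}(\land,\exists,\forall)$-refutation of size at most $p(n)$.
   Context: For literals/variables, $\mathrm{xor}_u(o_1,o_2,o,l_1,l_2) := (l_1\lor l_2\lor\neg o_1\lor o_2\lor o)\land(l_1\lor l_2\lor o_1\lor\neg o_2\lor o)\land(l_1\lor l_2\lor\neg o_1\lor\neg o_2\lor\neg o)\land(l_1\lor l_2\lor o_1\lor o_2\lor\neg o)$. $\textsc{QUParity}_n := \exists x_1\ldots\exists x_n\forall z_1\forall z_2\exists t_2\ldots\exists t_n.\ \mathrm{xor}_u(x_1,x_2,t_2,z_1,z_2)\land\mathrm{xor}_u(x_1,x_2,t_2,\neg z_1,\neg z_2)\land\bigwedge_{i=3}^n\big(\mathrm{xor}_u(t_{i-1},x_i,t_i,z_1,z_2)\land\mathrm{xor}_u(t_{i-1},x_i,t_i,\neg z_1,\neg z_2)\big)\land(z_1\lor z_2\lor t_n)\land(\neg z_1\lor\neg z_2\lor\neg t_n)$. For a PCNF $\Phi=Q_1x_1\ldots Q_nx_n.\,C_1\land\dots\land C_m$, an $\mathrm{OBDD}(\land,\exists,\forall)$ derivation from $\Phi$ is a sequence $L_1,\dots,L_k$ of OBDDs (ordered binary decision diagrams) all using the same variable order, where $L_i$ represents $C_i$ for $i\le m$ and each other $L_i$ is obtained by conjunction ($L_i$ represents $L_j\land L_{j'}$, $j,j'<i$), projection ($L_i$ represents $\exists x.L_j$ for a variable $x$ of $L_j$, $j<i$), or universal reduction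 ($L_i$ represents $L_j[u/c]$, $j<i$, $u$ universal and rightmost in the prefix among the variables of $L_j$, $c\in\{0,1\}$). Its size is the sum of the numbers of nodes of its OBDDs; a refutation ends with an OBDD representing the constant $0$. -}

module Defs where

open import Data.Bool using (Bool; true; false; if_then_else_; _∧_; _∨_; not)
open import Data.Nat using (ℕ; zero; suc; _+_; _*_; _∸_; _^_; _<_; _≡ᵇ_)
open import Data.List using (List; []; _∷_; _++_; [_]; map; concat; length; upTo; last; foldr)
open import Data.Bool.ListAction using (any)
open import Data.Nat.ListAction using (sum)
open import Data.List.Membership.Propositional using (_∈_)
open import Data.List.Relation.Binary.Pointwise using (Pointwise)
open import Data.Maybe using (Maybe; just; nothing)
open import Data.Product using (Σ; Σ-syntax; _×_; _,_; proj₂)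
open import Data.Sum using (_⊎_)
open import Data.Unit using (⊤)
open import Function.Definitions using (Injective)
open import Relation.Binary.PropositionalEquality using (_≡_)

Var : Set
Var = ℕ

Assignment : Set
Assignment = Var → Bool

_[_↦_] : Assignment → Var → Bool → Assignment
(ρ [ x ↦ b ]) y = if y ≡ᵇ x then b else ρ y

data Lit : Set where
  pos : Var → Lit
  neg : Var → Lit

¬ₗ : Lit → Lit
¬ₗ (pos v) = neg v
¬ₗ (neg v) = pos v

Clause : Set
Clause = List Lit

evalLit : Assignment → Lit → Bool
evalLit ρ (pos v) = ρ v
evalLit ρ (neg v) = not (ρ v)

evalClause : Clause → Assignment → Bool
evalClause C ρ = any (evalLit ρ) C

data Quant : Set where
  ∃q ∀q : Quant

Prefix : Set
Prefix = List (Quant × Var)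

record PCNF : Set where
  constructor _·_
  field
    prefix : Prefix
    matrix : List Clause
open PCNF public

-- An OBDD is a nonempty list of nodes; the head is the root.
-- A decision node (branch v lo hi) refers to its children by position
-- in the tail of the list (0 = the node directly after it), so the
-- graph is acyclic by construction and nodes may be shared.

data Node : Set where
  leaf   : Bool → Node
  branch : Var → (lo hi : ℕ) → Node

OBDD : Set
OBDD = List Node

nth : {A : Set} → List A → ℕ → Maybe A
nth []       _       = nothing
nth (x ∷ xs) zero    = just x
nth (x ∷ xs) (suc k) = nth xs k

getB : List Bool → ℕ → Bool
getB []       _       = false
getB (b ∷ bs) zero    = b
getB (b ∷ bs) (suc k) = getB bs k

values : OBDD → Assignment → List Bool
values []                    ρ = []
values (leaf b ∷ ns)         ρ = b ∷ values ns ρ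
values (branch v lo hi ∷ ns) ρ =
  (if ρ v then getB (values ns ρ) hi else getB (values ns ρ) lo) ∷ values ns ρ

eval : OBDD → Assignment → Bool
eval L ρ = getB (values L ρ) 0

size : OBDD → ℕ
size = length

vars : OBDD → List Var
vars []                    = []
vars (leaf _ ∷ ns)         = vars ns
vars (branch v _ _ ∷ ns)   = v ∷ vars ns

record VarOrder : Set where
  field
    rank      : Var → ℕ
    rank-inj  : Injective _≡_ _≡_ rank
open VarOrder public

ChildOK : VarOrder → Var → Maybe Node → Set
ChildOK π v (just (branch w _ _)) = rank π v < rank π w
ChildOK π v _                     = ⊤

NodesWF : VarOrder → OBDD → Set
NodesWF π []                    = ⊤
NodesWF π (leaf _ ∷ ns)         = NodesWF π ns
NodesWF π (branch v lo hi ∷ ns) =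
  (lo < length ns) × (hi < length ns) ×
  ChildOK π v (nth ns lo) × ChildOK π v (nth ns hi) × NodesWF π ns

IsOBDD : VarOrder → OBDD → Set
IsOBDD π []       = Data.Empty.⊥ where import Data.Empty
IsOBDD π (n ∷ ns) = NodesWF π (n ∷ ns)

Represents : OBDD → (Assignment → Bool) → Set
Represents L f = ∀ ρ → eval L ρ ≡ f ρ

UnivRightmost : Prefix → OBDD → Var → Set
UnivRightmost pre L u =
  Σ[ as ∈ Prefix ] Σ[ bs ∈ Prefix ]
    (pre ≡ as ++ ((∀q , u) ∷ bs)) ×
    (∀ v → v ∈ vars L → v ≡ u ⊎ v ∈ map proj₂ as)

data Justified (pre : Prefix) (prev : List OBDD) (L : OBDD) : Set where
  conj : (A B : OBDD) → A ∈ prev → B ∈ prev →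
         Represents L (λ ρ → eval A ρ ∧ eval B ρ) → Justified pre prev L
  proj : (A : OBDD) (x : Var) → A ∈ prev → x ∈ vars A →
         Represents L (λ ρ → eval A (ρ [ x ↦ false ]) ∨ eval A (ρ [ x ↦ true ])) →
         Justified pre prev L
  ured : (A : OBDD) (u : Var) (c : Bool) → A ∈ prev → u ∈ vars A →
         UnivRightmost pre A u →
         Represents L (λ ρ → eval A (ρ [ u ↦ c ])) → Justified pre prev L

data Steps (pre : Prefix) : List OBDD → List OBDD → Set where
  []  : ∀ {prev} → Steps pre prev []
  _∷_ : ∀ {prev L Ls} → Justified pre prev L →
        Steps pre (prev ++ [ L ]) Ls → Steps pre prev (L ∷ Ls)

record Refutation (Φ : PCNF) : Set where
  field
    order       : VarOrder
    clauseBDDs  : List OBDD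
    steps       : List OBDD
    clausesRep  : Pointwise (λ L C → Represents L (evalClause C)) clauseBDDs (matrix Φ)
    stepsValid  : Steps (prefix Φ) clauseBDDs steps
    allOBDD     : ∀ L → L ∈ clauseBDDs ++ steps → IsOBDD order L
    final       : OBDD
    finalIsLast : last (clauseBDDs ++ steps) ≡ just final
    finalFalse  : Represents final (λ _ → false)
open Refutation public

refSize : ∀ {Φ} → Refutation Φ → ℕ
refSize R = sum (map size (clauseBDDs R ++ steps R))

-- Polynomials with natural-number coefficients (coefficient list,
-- constant term first)

Poly : Set
Poly = List ℕ

evalPoly : Poly → ℕ → ℕ
evalPoly p n = foldr (λ a acc → a + n * acc) 0 p

-- QUParity_n.  Variable encoding: x_i ↦ i (1 ≤ i ≤ n), z_1 ↦ n+1,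
-- z_2 ↦ n+2, t_i ↦ n+2+i (2 ≤ i ≤ n).

xorU : Lit → Lit → Lit → Lit → Lit → List Clause
xorU o₁ o₂ o l₁ l₂ =
  (l₁ ∷ l₂ ∷ ¬ₗ o₁ ∷ o₂ ∷ o ∷ []) ∷
  (l₁ ∷ l₂ ∷ o₁ ∷ ¬ₗ o₂ ∷ o ∷ []) ∷
  (l₁ ∷ l₂ ∷ ¬ₗ o₁ ∷ ¬ₗ o₂ ∷ ¬ₗ o ∷ []) ∷
  (l₁ ∷ l₂ ∷ o₁ ∷ o₂ ∷ ¬ₗ o ∷ []) ∷ []

module QUP (n : ℕ) where
  xv : ℕ → Var
  xv i = i
  z₁ z₂ : Var
  z₁ = n + 1
  z₂ = n + 2
  tv : ℕ → Var
  tv i = n + 2 + i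

  from1 from2 from3 : List ℕ
  from1 = map (λ k → 1 + k) (upTo n)
  from2 = map (λ k → 2 + k) (upTo (n ∸ 1))
  from3 = map (λ k → 3 + k) (upTo (n ∸ 2))

  pre : Prefix
  pre = map (λ i → (∃q , xv i)) from1 ++
        ((∀q , z₁) ∷ (∀q , z₂) ∷ []) ++
        map (λ i → (∃q , tv i)) from2

  pair : Lit → Lit → Lit → List Clause
  pair a b c = xorU a b c (pos z₁) (pos z₂) ++ xorU a b c (neg z₁) (neg z₂)

  mat : List Clause
  mat = pair (pos (xv 1)) (pos (xv 2)) (pos (tv 2)) ++
        concat (map (λ i → pair (pos (tv (i ∸ 1))) (pos (xv i)) (pos (tv i))) from3) ++
        ((pos z₁ ∷ pos z₂ ∷ pos (tv n) ∷ []) ∷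
         (neg z₁ ∷ neg z₂ ∷ neg (tv n) ∷ []) ∷ [])

QUParity : ℕ → PCNF
QUParity n = QUP.pre n · QUP.mat n

-- Every OBDD of the refutation reads x₁ ⊕ … ⊕ xₘ along a chain of two nodes per variable and
-- then branches on at most five further variables through a complete decision tree, so it has
-- at most 2n + 126 nodes. The derivation maintains the invariant "tⱼ = x₁ ⊕ … ⊕ xⱼ unless
-- z₁ ≠ z₂": conjoining it with the eight clauses of the next pair and projecting out tⱼ gives
-- the invariant for j + 1, at a cost of 17 OBDDs per pair. From the invariant for n and the
-- clauses z₁ ∨ z₂ ∨ tₙ and ¬z₁ ∨ ¬z₂ ∨ ¬tₙ, projecting out tₙ and then reducing z₂ and z₁ both
-- to 0 leaves x₁ ⊕ … ⊕ xₙ, both to 1 leaves its negation, and their conjunction is 0.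

module Submission where

open import Defs
open import Data.Bool using (Bool; true; false; _∧_; _∨_; not; _xor_; if_then_else_; T)
open import Data.Bool.Properties
  using (not-involutive; ∧-assoc; ∧-identityʳ; ∨-identityʳ; xor-assoc; xor-identityʳ)
open import Data.Bool.ListAction using (all)
open import Data.Nat using (ℕ; zero; suc; _+_; _*_; _∸_; _≤_; _<_; z≤n; s≤s; _≡ᵇ_)
open import Data.Nat.Properties
open import Data.List using (List; []; _∷_; _++_; length; foldr; map; concat; last; upTo; applyUpTo)
open import Data.List.Relation.Binary.Pointwise as PW using (Pointwise; []; _∷_)
import Data.List.Relation.Binary.Pointwise.Properties as PWP
open import Data.List.Properties
  using (length-++; length-map; length-upTo; ++-assoc; ++-identityʳ; map-upTo)
open import Data.Nat.ListAction using (sum)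
open import Data.Nat.Solver using (module +-*-Solver)
open +-*-Solver using (solve; _:+_; _:*_; _:=_; con)
open import Data.List.Relation.Binary.Subset.Propositional using (_⊆_)
open import Data.List.Relation.Unary.All as AllL using ([]; _∷_)
import Data.List.Relation.Unary.All.Properties as AllP
open import Data.List.Membership.Propositional using (_∈_)
open import Data.List.Membership.Propositional.Properties using (∈-++⁺ˡ; ∈-++⁺ʳ; ∈-++⁻; ∈-map⁺; ∈-concat⁺′)
open import Data.List.Relation.Unary.Any using (here; there)
open import Data.Vec as Vec using (Vec; []; _∷_; toList)
open import Data.Vec.Properties using (map-++)
open import Data.Vec.Relation.Unary.All as All using (All; []; _∷_)
open import Data.Vec.Relation.Unary.Linked.Properties using (Linked⇒All)
open import Data.Vec.Relation.Unary.Linked as Linked using (Linked; []; [-]; _∷_)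
open import Data.Maybe using (just)
open import Data.Product using (Σ-syntax; _×_; _,_; proj₁; proj₂)
open import Data.Sum using (_⊎_; inj₁; inj₂)
open import Data.Unit using (⊤; tt)
open import Data.Empty using (⊥-elim)
open import Function using (_∘_)
open import Relation.Binary.PropositionalEquality

getB-++ˡ : ∀ xs ys {k} → k < length xs → getB (xs ++ ys) k ≡ getB xs k
getB-++ˡ (x ∷ xs) ys {zero}  _         = refl
getB-++ˡ (x ∷ xs) ys {suc k} (s≤s k<) = getB-++ˡ xs ys k<

getB-++ʳ : ∀ xs ys → getB (xs ++ ys) (length xs) ≡ getB ys 0
getB-++ʳ []       ys = refl
getB-++ʳ (x ∷ xs) ys = getB-++ʳ xs ys

nth-++ˡ : ∀ {A : Set} (xs ys : List A) {k} → k < length xs → nth (xs ++ ys) k ≡ nth xs k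
nth-++ˡ (x ∷ xs) ys {zero}  _         = refl
nth-++ˡ (x ∷ xs) ys {suc k} (s≤s k<) = nth-++ˡ xs ys k<

nth-++ʳ : ∀ {A : Set} (xs ys : List A) → nth (xs ++ ys) (length xs) ≡ nth ys 0
nth-++ʳ []       ys = refl
nth-++ʳ (x ∷ xs) ys = nth-++ʳ xs ys

<-length-++ : ∀ {A : Set} (xs ys : List A) {k} → k < length xs → k < length (xs ++ ys)
<-length-++ xs ys k< = ≤-trans k< (≤-trans (m≤m+n _ _) (≤-reflexive (sym (length-++ xs))))

length-values : ∀ L ρ → length (values L ρ) ≡ length L
length-values []                   ρ = refl
length-values (leaf b ∷ L)         ρ = cong suc (length-values L ρ)
length-values (branch v lo hi ∷ L) ρ = cong suc (length-values L ρ)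

Closed : OBDD → Set
Closed []                    = ⊤
Closed (leaf _ ∷ ns)         = Closed ns
Closed (branch v lo hi ∷ ns) = lo < length ns × hi < length ns × Closed ns

bothAssigned-++ : ∀ A B → Closed A → Closed B → Closed (A ++ B)
bothAssigned-++ []                  B _                   cB = cB
bothAssigned-++ (leaf _ ∷ A)        B cA                  cB = bothAssigned-++ A B cA cB
bothAssigned-++ (branch _ _ _ ∷ A) B (lo< , hi< , cA) cB =
  <-length-++ A B lo< , <-length-++ A B hi< , bothAssigned-++ A B cA cB

values-++ : ∀ A B ρ → Closed A → values (A ++ B) ρ ≡ values A ρ ++ values B ρ
values-++ []                   B ρ _ = refl
values-++ (leaf b ∷ A)         B ρ c = cong (b ∷_) (values-++ A B ρ c)
values-++ (branch v lo hi ∷ A) B ρ (lo< , hi< , c) rewrite values-++ A B ρ c =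
  cong (_∷ values A ρ ++ values B ρ)
    (cong₂ (if ρ v then_else_) (getB-++ˡ (values A ρ) (values B ρ) (inside hi<))
                               (getB-++ˡ (values A ρ) (values B ρ) (inside lo<)))
  where
  inside : ∀ {k} → k < length A → k < length (values A ρ)
  inside = subst (_ <_) (sym (length-values A ρ))

entry-++ˡ : ∀ A B ρ → Closed A → 0 < length A → getB (values (A ++ B) ρ) 0 ≡ eval A ρ
entry-++ˡ A B ρ c 0<A = trans (cong (λ vs → getB vs 0) (values-++ A B ρ c))
  (getB-++ˡ (values A ρ) (values B ρ) (subst (0 <_) (sym (length-values A ρ)) 0<A))

entry-++ʳ : ∀ A B ρ → Closed A → getB (values (A ++ B) ρ) (length A) ≡ eval B ρ
entry-++ʳ A B ρ c = trans (cong (λ vs → getB vs (length A)) (values-++ A B ρ c))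
  (subst (λ k → getB (values A ρ ++ values B ρ) k ≡ eval B ρ) (length-values A ρ)
         (getB-++ʳ (values A ρ) (values B ρ)))

vars-++ : ∀ A B → vars (A ++ B) ≡ vars A ++ vars B
vars-++ []                  B = refl
vars-++ (leaf _ ∷ A)        B = vars-++ A B
vars-++ (branch v _ _ ∷ A) B = cong (v ∷_) (vars-++ A B)

decisionTree : ∀ {k} → Vec Var k → (Vec Bool k → Bool) → OBDD
decisionTree []       f = leaf (f []) ∷ []
decisionTree (v ∷ vs) f =
  branch v 0 (length (decisionTree vs (f ∘ (false ∷_))))
    ∷ decisionTree vs (f ∘ (false ∷_)) ++ decisionTree vs (f ∘ (true ∷_))

treeSize : ℕ → ℕ
treeSize zero    = 1
treeSize (suc k) = suc (treeSize k + treeSize k)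

length-decisionTree : ∀ {k} (vs : Vec Var k) f → length (decisionTree vs f) ≡ treeSize k
length-decisionTree []       f = refl
length-decisionTree (v ∷ vs) f = cong suc (trans (length-++ (decisionTree vs _))
  (cong₂ _+_ (length-decisionTree vs _) (length-decisionTree vs _)))

decisionTree-nonempty : ∀ {k} (vs : Vec Var k) f → 0 < length (decisionTree vs f)
decisionTree-nonempty []      f = s≤s z≤n
decisionTree-nonempty (_ ∷ _) f = s≤s z≤n

bothAssigned-decisionTree : ∀ {k} (vs : Vec Var k) f → Closed (decisionTree vs f)
bothAssigned-decisionTree []       f = tt
bothAssigned-decisionTree (v ∷ vs) f =
  <-length-++ L R (decisionTree-nonempty vs _) ,
  subst (length L <_) (sym (length-++ L)) (m<m+n (length L) (decisionTree-nonempty vs _)) ,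
  bothAssigned-++ L R (bothAssigned-decisionTree vs _) (bothAssigned-decisionTree vs _)
  where
  L = decisionTree vs (f ∘ (false ∷_))
  R = decisionTree vs (f ∘ (true ∷_))

eval-decisionTree : ∀ {k} (vs : Vec Var k) f ρ → eval (decisionTree vs f) ρ ≡ f (Vec.map ρ vs)
eval-decisionTree []       f ρ = refl
eval-decisionTree (v ∷ vs) f ρ with ρ v
... | false = trans (entry-++ˡ (decisionTree vs (f ∘ (false ∷_))) _ ρ (bothAssigned-decisionTree vs _)
                                (decisionTree-nonempty vs _))
                    (eval-decisionTree vs _ ρ)
... | true  = trans (entry-++ʳ (decisionTree vs (f ∘ (false ∷_))) _ ρ (bothAssigned-decisionTree vs _))
                    (eval-decisionTree vs _ ρ)

vars-decisionTree⁻ : ∀ {k} (vs : Vec Var k) f {v} → v ∈ vars (decisionTree vs f) → v ∈ toList vs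
vars-decisionTree⁻ (w ∷ vs) f (here refl) = here refl
vars-decisionTree⁻ (w ∷ vs) f (there v∈)
  with ∈-++⁻ (vars (decisionTree vs _)) (subst (_ ∈_) (vars-++ (decisionTree vs _) _) v∈)
... | inj₁ v∈L = there (vars-decisionTree⁻ vs _ v∈L)
... | inj₂ v∈R = there (vars-decisionTree⁻ vs _ v∈R)

vars-decisionTree⁺ : ∀ {k} (vs : Vec Var k) f {v} → v ∈ toList vs → v ∈ vars (decisionTree vs f)
vars-decisionTree⁺ (w ∷ vs) f (here refl) = here refl
vars-decisionTree⁺ (w ∷ vs) f (there v∈) =
  there (subst (_ ∈_) (sym (vars-++ (decisionTree vs _) _)) (∈-++⁺ˡ (vars-decisionTree⁺ vs _ v∈)))

range : ℕ → ℕ → List ℕ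
range a zero    = []
range a (suc m) = a ∷ range (suc a) m

parity : Assignment → List Var → Bool
parity ρ = foldr (λ v b → ρ v xor b) false

oddEntry : List Var → ℕ → ℕ
oddEntry []      e = e
oddEntry (_ ∷ _) e = 1

-- Two nodes per variable, at positions 0 and 1, record an even resp. odd parity read so far;
-- the chain ends in T, entered at 0 on even and at e on odd parity.
parityChain : List Var → OBDD → ℕ → OBDD
parityChain []       T e = T
parityChain (v ∷ vs) T e =
  branch v 1 (suc (oddEntry vs e)) ∷ branch v (oddEntry vs e) 0 ∷ parityChain vs T e

entry : ℕ → Bool → ℕ
entry e b = if b then e else 0

eval-parityChain : ∀ vs T e ρ →
  getB (values (parityChain vs T e) ρ) 0 ≡ getB (values T ρ) (entry e (parity ρ vs)) ×
  getB (values (parityChain vs T e) ρ) (oddEntry vs e) ≡ getB (values T ρ) (entry e (not (parity ρ vs)))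
eval-parityChain []       T e ρ = refl , refl
eval-parityChain (v ∷ vs) T e ρ with ρ v | eval-parityChain vs T e ρ
... | false | even , odd = even , odd
... | true  | even , odd = odd , trans even (cong (getB (values T ρ) ∘ entry e) (sym (not-involutive _)))

vars-parityChain⁻ : ∀ xs T e {v} → v ∈ vars (parityChain xs T e) → v ∈ xs ⊎ v ∈ vars T
vars-parityChain⁻ []       T e v∈                   = inj₂ v∈
vars-parityChain⁻ (x ∷ xs) T e (here refl)          = inj₁ (here refl)
vars-parityChain⁻ (x ∷ xs) T e (there (here refl))  = inj₁ (here refl)
vars-parityChain⁻ (x ∷ xs) T e (there (there v∈)) with vars-parityChain⁻ xs T e v∈
... | inj₁ v∈xs = inj₁ (there v∈xs)
... | inj₂ v∈T  = inj₂ v∈T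

vars-parityChain⁺ : ∀ xs T e {v} → v ∈ vars T → v ∈ vars (parityChain xs T e)
vars-parityChain⁺ []       T e v∈ = v∈
vars-parityChain⁺ (x ∷ xs) T e v∈ = there (there (vars-parityChain⁺ xs T e v∈))

length-parityChain : ∀ a m T e → length (parityChain (range a m) T e) ≡ m + m + length T
length-parityChain a zero    T e = refl
length-parityChain a (suc m) T e = cong suc (trans (cong suc (length-parityChain (suc a) m T e))
                                                   (cong (_+ length T) (sym (+-suc m m))))

parity-range-suc : ∀ ρ a m → parity ρ (range a (suc m)) ≡ parity ρ (range a m) xor ρ (a + m)
parity-range-suc ρ a zero    = trans (xor-identityʳ (ρ a)) (cong ρ (sym (+-identityʳ a)))
parity-range-suc ρ a (suc m) = begin
  ρ a xor parity ρ (range (suc a) (suc m))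
    ≡⟨ cong (ρ a xor_) (parity-range-suc ρ (suc a) m) ⟩
  ρ a xor (parity ρ (range (suc a) m) xor ρ (suc a + m))
    ≡⟨ sym (xor-assoc (ρ a) _ _) ⟩
  (ρ a xor parity ρ (range (suc a) m)) xor ρ (suc a + m)
    ≡⟨ cong (λ v → (ρ a xor parity ρ (range (suc a) m)) xor ρ v) (sym (+-suc a m)) ⟩
  (ρ a xor parity ρ (range (suc a) m)) xor ρ (a + suc m) ∎
  where open ≡-Reasoning

applyUpTo-range : ∀ {f : ℕ → ℕ} a m → (∀ k → f k ≡ a + k) → applyUpTo f m ≡ range a m
applyUpTo-range a zero    f≗ = refl
applyUpTo-range a (suc m) f≗ = cong₂ _∷_ (trans (f≗ 0) (+-identityʳ a))
  (applyUpTo-range (suc a) m (λ k → trans (f≗ (suc k)) (+-suc a k)))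

map-upTo-range : ∀ a m → map (a +_) (upTo m) ≡ range a m
map-upTo-range a m = trans (map-upTo (a +_) m) (applyUpTo-range a m (λ _ → refl))

range-bounds : ∀ {v} a m → v ∈ range a m → a ≤ v × v < a + m
range-bounds a (suc m) (here refl) = ≤-refl , m<m+n a (s≤s z≤n)
range-bounds {v} a (suc m) (there v∈) with range-bounds (suc a) m v∈
... | a<v , v<a+m = <⇒≤ a<v , subst (v <_) (sym (+-suc a m)) v<a+m

-- Well-formedness for the order x₁ < … < xₙ < z₁ < z₂ < t₂ < … < tₙ

idOrder : VarOrder
idOrder = record { rank = λ v → v ; rank-inj = λ eq → eq }

NodesWF-++ : ∀ {π} A B → NodesWF π A → NodesWF π B → NodesWF π (A ++ B)
NodesWF-++ []                   B _                              wB = wB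
NodesWF-++ (leaf _ ∷ A)         B wA                             wB = NodesWF-++ A B wA wB
NodesWF-++ {π} (branch v lo hi ∷ A) B (lo< , hi< , okₗ , okₕ , wA) wB =
  <-length-++ A B lo< , <-length-++ A B hi< ,
  subst (ChildOK π v) (sym (nth-++ˡ A B lo<)) okₗ ,
  subst (ChildOK π v) (sym (nth-++ˡ A B hi<)) okₕ ,
  NodesWF-++ A B wA wB

Entries : Var → OBDD → ℕ → Set
Entries v T e = 0 < length T × e < length T × ChildOK idOrder v (nth T 0) × ChildOK idOrder v (nth T e)

root-decisionTree : ∀ {k v} (vs : Vec Var k) f → Linked _<_ (v ∷ vs) →
                    ChildOK idOrder v (nth (decisionTree vs f) 0)
root-decisionTree []      f _         = tt
root-decisionTree (w ∷ _) f (v<w ∷ _) = v<w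

entries-decisionTrees : ∀ {k v} (vs : Vec Var k) f f′ → Linked _<_ (v ∷ vs) →
  Entries v (decisionTree vs f ++ decisionTree vs f′) (length (decisionTree vs f))
entries-decisionTrees vs f f′ l =
  <-length-++ L R (decisionTree-nonempty vs _) ,
  subst (length L <_) (sym (length-++ L)) (m<m+n (length L) (decisionTree-nonempty vs _)) ,
  subst (ChildOK idOrder _) (sym (nth-++ˡ L R (decisionTree-nonempty vs _))) (root-decisionTree vs _ l) ,
  subst (ChildOK idOrder _) (sym (nth-++ʳ L R)) (root-decisionTree vs _ l)
  where
  L = decisionTree vs f
  R = decisionTree vs f′

wf-decisionTree : ∀ {k} (vs : Vec Var k) f → Linked _<_ vs → NodesWF idOrder (decisionTree vs f)
wf-decisionTree []       f _ = tt
wf-decisionTree (v ∷ vs) f l with entries-decisionTrees vs (f ∘ (false ∷_)) (f ∘ (true ∷_)) l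
... | 0< , e< , ok₀ , okₑ =
  0< , e< , ok₀ , okₑ ,
  NodesWF-++ (decisionTree vs _) _ (wf-decisionTree vs _ (Linked.tail l))
                                   (wf-decisionTree vs _ (Linked.tail l))

entries-parityChain : ∀ a m T e → (∀ {v} → v < a + suc m → Entries v T e) →
                      Entries a (parityChain (range (suc a) m) T e) (oddEntry (range (suc a) m) e)
entries-parityChain a zero    T e below = below (m<m+n a (s≤s z≤n))
entries-parityChain a (suc m) T e _     = s≤s z≤n , s≤s (s≤s z≤n) , n<1+n a , n<1+n a

wf-parityChain : ∀ a m T e → (∀ {v} → v < a + m → Entries v T e) → NodesWF idOrder T →
                 NodesWF idOrder (parityChain (range a m) T e)
wf-parityChain a zero    T e below w = w
wf-parityChain a (suc m) T e below w with entries-parityChain a m T e below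
... | 0< , o< , ok₀ , okₒ =
  s≤s 0< , s≤s o< , ok₀ , okₒ , o< , 0< , okₒ , ok₀ ,
  wf-parityChain (suc a) m T e (λ {v} → below ∘ subst (v <_) (sym (+-suc a m))) w

linked-lower : ∀ {k u v} {vs : Vec Var k} → u ≤ v → Linked _<_ (v ∷ vs) → Linked _<_ (u ∷ vs)
linked-lower u≤v [-]         = [-]
linked-lower u≤v (v<w ∷ vs<) = ≤-<-trans u≤v v<w ∷ vs<

-- Opaque: these OBDDs are large terms that are only used through the lemmas of the block,
-- and letting the unifier unfold them makes type checking prohibitively slow.
opaque
  -- the chain reads x₁ … xₘ, which are the variables 1 … m
  parityBDD : ∀ {k} → ℕ → Vec Var k → (Bool → Vec Bool k → Bool) → OBDD
  parityBDD m vs g =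
    parityChain (range 1 m) (decisionTree vs (g false) ++ decisionTree vs (g true))
                            (length (decisionTree vs (g false)))

  eval-parityBDD : ∀ {k} m (vs : Vec Var k) g ρ →
                   eval (parityBDD m vs g) ρ ≡ g (parity ρ (range 1 m)) (Vec.map ρ vs)
  eval-parityBDD m vs g ρ =
    trans (proj₁ (eval-parityChain (range 1 m) _ _ ρ)) (readTree (parity ρ (range 1 m)))
    where
    readTree : ∀ b → getB (values (decisionTree vs (g false) ++ decisionTree vs (g true)) ρ)
                          (entry (length (decisionTree vs (g false))) b)
                     ≡ g b (Vec.map ρ vs)
    readTree false = trans (entry-++ˡ (decisionTree vs (g false)) _ ρ (bothAssigned-decisionTree vs _)
                                      (decisionTree-nonempty vs _))
                           (eval-decisionTree vs _ ρ)
    readTree true  = trans (entry-++ʳ (decisionTree vs (g false)) _ ρ (bothAssigned-decisionTree vs _))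
                           (eval-decisionTree vs _ ρ)

  vars-parityBDD⁻ : ∀ {k} m (vs : Vec Var k) g {v} →
                    v ∈ vars (parityBDD m vs g) → v ∈ range 1 m ⊎ v ∈ toList vs
  vars-parityBDD⁻ m vs g v∈ with vars-parityChain⁻ (range 1 m) _ _ v∈
  ... | inj₁ v∈xs = inj₁ v∈xs
  ... | inj₂ v∈T with ∈-++⁻ (vars (decisionTree vs _)) (subst (_ ∈_) (vars-++ (decisionTree vs _) _) v∈T)
  ...   | inj₁ v∈T₀ = inj₂ (vars-decisionTree⁻ vs _ v∈T₀)
  ...   | inj₂ v∈T₁ = inj₂ (vars-decisionTree⁻ vs _ v∈T₁)

  vars-parityBDD⁺ : ∀ {k} m (vs : Vec Var k) g {v} → v ∈ toList vs → v ∈ vars (parityBDD m vs g)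
  vars-parityBDD⁺ m vs g v∈ = vars-parityChain⁺ (range 1 m) _ _
    (subst (_ ∈_) (sym (vars-++ (decisionTree vs _) _)) (∈-++⁺ˡ (vars-decisionTree⁺ vs _ v∈)))

  size-parityBDD : ∀ {k} m (vs : Vec Var k) g → size (parityBDD m vs g) ≡ m + m + (treeSize k + treeSize k)
  size-parityBDD m vs g = trans (length-parityChain 1 m _ _) (cong (m + m +_)
    (trans (length-++ (decisionTree vs _))
           (cong₂ _+_ (length-decisionTree vs _) (length-decisionTree vs _))))

  parityBDD-nonempty : ∀ {k} m (vs : Vec Var k) g → 0 < length (parityBDD m vs g)
  parityBDD-nonempty zero    vs g = <-length-++ (decisionTree vs _) _ (decisionTree-nonempty vs _)
  parityBDD-nonempty (suc m) vs g = s≤s z≤n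

  wf-parityBDD : ∀ {k} m (vs : Vec Var k) g → Linked _<_ (m ∷ vs) → IsOBDD idOrder (parityBDD m vs g)
  wf-parityBDD m vs g l = isOBDD (parityBDD m vs g) (parityBDD-nonempty m vs g)
    (wf-parityChain 1 m _ _ (λ { (s≤s v≤m) → entries-decisionTrees vs _ _ (linked-lower v≤m l) })
      (NodesWF-++ (decisionTree vs _) _ (wf-decisionTree vs _ (Linked.tail l))
                                         (wf-decisionTree vs _ (Linked.tail l))))
    where
    isOBDD : ∀ L → 0 < length L → NodesWF idOrder L → IsOBDD idOrder L
    isOBDD (_ ∷ _) _ w = w

record Bounded (n : ℕ) (L : OBDD) : Set where
  field
    ordered : IsOBDD idOrder L
    small   : size L ≤ n + n + (treeSize 5 + treeSize 5)

treeSize-mono : ∀ {k l} → k ≤ l → treeSize k ≤ treeSize l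
treeSize-mono {zero}  {zero}  _         = ≤-refl
treeSize-mono {zero}  {suc l} _         = s≤s z≤n
treeSize-mono {suc k} {suc l} (s≤s k≤l) = s≤s (+-mono-≤ (treeSize-mono k≤l) (treeSize-mono k≤l))

parityBDD-bounded : ∀ {k n} m (vs : Vec Var k) g → m ≤ n → k ≤ 5 → Linked _<_ (m ∷ vs) →
                    Bounded n (parityBDD m vs g)
parityBDD-bounded m vs g m≤n k≤5 l = record
  { ordered = wf-parityBDD m vs g l
  ; small   = subst (_≤ _) (sym (size-parityBDD m vs g))
      (+-mono-≤ (+-mono-≤ m≤n m≤n) (+-mono-≤ (treeSize-mono k≤5) (treeSize-mono k≤5)))
  }

update-same : ∀ ρ x b → (ρ [ x ↦ b ]) x ≡ b
update-same ρ x b with x ≡ᵇ x in eq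
... | true  = refl
... | false = ⊥-elim (subst T eq (≡⇒≡ᵇ x x refl))

update-other : ∀ ρ x b {y} → y ≢ x → (ρ [ x ↦ b ]) y ≡ ρ y
update-other ρ x b {y} y≢x with y ≡ᵇ x in eq
... | true  = ⊥-elim (y≢x (≡ᵇ⇒≡ y x (subst T (sym eq) tt)))
... | false = refl

map-update-∉ : ∀ {k} ρ x b {vs : Vec Var k} → All (_≢ x) vs → Vec.map (ρ [ x ↦ b ]) vs ≡ Vec.map ρ vs
map-update-∉ ρ x b []           = refl
map-update-∉ ρ x b (v≢x ∷ vs≢x) = cong₂ _∷_ (update-other ρ x b v≢x) (map-update-∉ ρ x b vs≢x)

parity-update : ∀ ρ x b a m → a + m ≤ x → parity (ρ [ x ↦ b ]) (range a m) ≡ parity ρ (range a m)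
parity-update ρ x b a zero    _    = refl
parity-update ρ x b a (suc m) a+m≤x = cong₂ _xor_
  (update-other ρ x b (<⇒≢ (<-≤-trans (s≤s (m≤m+n a m)) a+m≤x′)))
  (parity-update ρ x b (suc a) m a+m≤x′)
  where
  a+m≤x′ : suc a + m ≤ x
  a+m≤x′ = subst (_≤ x) (+-suc a m) a+m≤x

linked-split : ∀ {k l m x} (us : Vec Var k) {ws : Vec Var l} → Linked _<_ (m ∷ us Vec.++ x ∷ ws) →
               m < x × All (_< x) us × All (x <_) ws
linked-split []       (m<x ∷ l) = m<x , [] , above l
  where
  above : ∀ {l x} {ws : Vec Var l} → Linked _<_ (x ∷ ws) → All (x <_) ws
  above [-]       = []
  above (x<w ∷ l) = Linked⇒All <-trans x<w l
linked-split (u ∷ us) (m<u ∷ l) with linked-split us l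
... | u<x , us<x , x<ws = <-trans m<u u<x , u<x ∷ us<x , x<ws

eval-parityBDD-update : ∀ {k l} m (us : Vec Var k) x (ws : Vec Var l) g ρ b →
  Linked _<_ (m ∷ us Vec.++ x ∷ ws) →
  eval (parityBDD m (us Vec.++ x ∷ ws) g) (ρ [ x ↦ b ])
    ≡ g (parity ρ (range 1 m)) (Vec.map ρ us Vec.++ b ∷ Vec.map ρ ws)
eval-parityBDD-update m us x ws g ρ b l with linked-split us l
... | m<x , us<x , x<ws = begin
  eval (parityBDD m (us Vec.++ x ∷ ws) g) ρ′
    ≡⟨ eval-parityBDD m _ g ρ′ ⟩
  g (parity ρ′ (range 1 m)) (Vec.map ρ′ (us Vec.++ x ∷ ws))
    ≡⟨ cong₂ g (parity-update ρ x b 1 m m<x) (map-++ ρ′ us (x ∷ ws)) ⟩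
  g (parity ρ (range 1 m)) (Vec.map ρ′ us Vec.++ ρ′ x ∷ Vec.map ρ′ ws)
    ≡⟨ cong (g _) (cong₂ Vec._++_ (map-update-∉ ρ x b (All.map <⇒≢ us<x))
                              (cong₂ _∷_ (update-same ρ x b) (map-update-∉ ρ x b (All.map >⇒≢ x<ws)))) ⟩
  g (parity ρ (range 1 m)) (Vec.map ρ us Vec.++ b ∷ Vec.map ρ ws) ∎
  where
  open ≡-Reasoning
  ρ′ = ρ [ x ↦ b ]

-- variable i is read as the i-th bit (false beyond k)
slot : ∀ {k} → Vec Bool k → Assignment
slot []       _       = false
slot (b ∷ bs) zero    = b
slot (b ∷ bs) (suc i) = slot bs i

satisfies : List Clause → Assignment → Bool
satisfies Cs σ = all (λ C → evalClause C σ) Cs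

satisfies-++ : ∀ Cs Ds σ → satisfies (Cs ++ Ds) σ ≡ satisfies Cs σ ∧ satisfies Ds σ
satisfies-++ []       Ds σ = refl
satisfies-++ (C ∷ Cs) Ds σ =
  trans (cong (evalClause C σ ∧_) (satisfies-++ Cs Ds σ)) (sym (∧-assoc (evalClause C σ) _ _))

tracks : Bool → Bool → Bool → Bool
tracks s t p = s ∨ not (t xor p)

xorU-satisfies : ∀ σ a b c l₁ l₂ → satisfies (xorU (pos a) (pos b) (pos c) l₁ l₂) σ
                                   ≡ evalLit σ l₁ ∨ (evalLit σ l₂ ∨ not (σ c xor (σ a xor σ b)))
xorU-satisfies σ a b c l₁ l₂ = core (evalLit σ l₁) (evalLit σ l₂) (σ a) (σ b) (σ c)
  where
  -- stated through slot, so that both sides unfold to the same Boolean term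
  core : ∀ g₁ g₂ x y z →
         satisfies (xorU (pos 2) (pos 3) (pos 4) (pos 0) (pos 1)) (slot (g₁ ∷ g₂ ∷ x ∷ y ∷ z ∷ []))
         ≡ g₁ ∨ (g₂ ∨ not (z xor (x xor y)))
  core true  _     _     _     _     = refl
  core false true  _     _     _     = refl
  core false false false false false = refl
  core false false false false true  = refl
  core false false false true  false = refl
  core false false false true  true  = refl
  core false false true  false false = refl
  core false false true  false true  = refl
  core false false true  true  false = refl
  core false false true  true  true  = refl

pairClauses : Var → Var → Var → Var → Var → List Clause
pairClauses a b c u₁ u₂ =
  xorU (pos a) (pos b) (pos c) (pos u₁) (pos u₂) ++ xorU (pos a) (pos b) (pos c) (neg u₁) (neg u₂)

satisfies-pairClauses : ∀ σ a b c u₁ u₂ →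
  satisfies (pairClauses a b c u₁ u₂) σ ≡ tracks (σ u₁ xor σ u₂) (σ c) (σ a xor σ b)
satisfies-pairClauses σ a b c u₁ u₂ = begin
  satisfies (X⁺ ++ X⁻) σ
    ≡⟨ satisfies-++ X⁺ X⁻ σ ⟩
  satisfies X⁺ σ ∧ satisfies X⁻ σ
    ≡⟨ cong₂ _∧_ (xorU-satisfies σ a b c (pos u₁) (pos u₂)) (xorU-satisfies σ a b c (neg u₁) (neg u₂)) ⟩
  (σ u₁ ∨ (σ u₂ ∨ e)) ∧ (not (σ u₁) ∨ (not (σ u₂) ∨ e))
    ≡⟨ guards (σ u₁) (σ u₂) e ⟩
  tracks (σ u₁ xor σ u₂) (σ c) (σ a xor σ b) ∎
  where
  open ≡-Reasoning
  X⁺ = xorU (pos a) (pos b) (pos c) (pos u₁) (pos u₂)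
  X⁻ = xorU (pos a) (pos b) (pos c) (neg u₁) (neg u₂)
  e  = not (σ c xor (σ a xor σ b))
  guards : ∀ y₁ y₂ e → (y₁ ∨ (y₂ ∨ e)) ∧ (not y₁ ∨ (not y₂ ∨ e)) ≡ (y₁ xor y₂) ∨ e
  guards true  true  e = refl
  guards true  false e = refl
  guards false true  e = refl
  guards false false e = ∧-identityʳ e

tracks-∃ : ∀ s t p x → tracks s t (p xor x)
           ≡ (tracks s false p ∧ tracks s t (false xor x)) ∨ (tracks s true p ∧ tracks s t (true xor x))
tracks-∃ true  t p     x = refl
tracks-∃ false t false x = sym (∨-identityʳ _)
tracks-∃ false t true  x = refl

Steps-++ : ∀ {pre prev} As {Bs} → Steps pre prev As → Steps pre (prev ++ As) Bs → Steps pre prev (As ++ Bs)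
Steps-++ {pre} {prev} []       {Bs} []        Bs-ok = subst (λ P → Steps pre P Bs) (++-identityʳ prev) Bs-ok
Steps-++ {pre} {prev} (A ∷ As) {Bs} (j ∷ As-ok) Bs-ok =
  j ∷ Steps-++ As As-ok (subst (λ P → Steps pre P Bs) (sym (++-assoc prev (A ∷ []) As)) Bs-ok)

new : ∀ {A : Set} {x : A} {xs} → x ∈ xs ++ x ∷ []
new {xs = xs} = ∈-++⁺ʳ xs (here refl)

old : ∀ {A : Set} {x y : A} {xs} → x ∈ xs → x ∈ xs ++ y ∷ []
old = ∈-++⁺ˡ

last-++ : ∀ {A : Set} (xs ys : List A) {z} → last ys ≡ just z → last (xs ++ ys) ≡ just z
last-++ []            ys       eq = eq
last-++ (x ∷ [])      (y ∷ ys) eq = eq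
last-++ (x ∷ x′ ∷ xs) ys       eq = last-++ (x′ ∷ xs) ys eq

opaque
  -- With no parity variables the two trees coincide; keeping the copy gives every OBDD one shape.
  cnfBDD : ∀ {k} → Vec Var k → List Clause → OBDD
  cnfBDD vs Cs = parityBDD 0 vs (λ _ bs → satisfies Cs (slot bs))

  eval-cnfBDD : ∀ {k} (vs : Vec Var k) Cs ρ → eval (cnfBDD vs Cs) ρ ≡ satisfies Cs (slot (Vec.map ρ vs))
  eval-cnfBDD vs Cs = eval-parityBDD 0 vs (λ _ bs → satisfies Cs (slot bs))

  cnfBDD-bounded : ∀ {k n} (vs : Vec Var k) Cs → k ≤ 5 → Linked _<_ (0 ∷ vs) → Bounded n (cnfBDD vs Cs)
  cnfBDD-bounded vs Cs k≤5 l = parityBDD-bounded 0 vs _ z≤n k≤5 l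

clause-represents : ∀ {k} (vs : Vec Var k) C →
                    Represents (cnfBDD vs (C ∷ [])) (λ ρ → evalClause C (slot (Vec.map ρ vs)))
clause-represents vs C ρ = trans (eval-cnfBDD vs (C ∷ []) ρ) (∧-identityʳ _)

clauseOBDDs : ∀ {k} → Vec Var k → List Clause → List OBDD
clauseOBDDs vs = map (λ C → cnfBDD vs (C ∷ []))

conjoin : ∀ {k} → Vec Var k → List Clause → List OBDD
conjoin vs []           = []
conjoin vs (C ∷ [])     = []
conjoin vs (C ∷ D ∷ Ds) = conjoin vs (D ∷ Ds) ++ cnfBDD vs (C ∷ D ∷ Ds) ∷ []

conjoin-result : ∀ {k prev} (vs : Vec Var k) Cs → Cs ≢ [] → clauseOBDDs vs Cs ⊆ prev →
                 cnfBDD vs Cs ∈ prev ++ conjoin vs Cs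
conjoin-result vs []           Cs≢[] _   = ⊥-elim (Cs≢[] refl)
conjoin-result vs (C ∷ [])     _     sub = ∈-++⁺ˡ (sub (here refl))
conjoin-result {prev = prev} vs (C ∷ D ∷ Ds) _ sub = ∈-++⁺ʳ prev (new {xs = conjoin vs (D ∷ Ds)})

conjoin-steps : ∀ {pre k prev} (vs : Vec Var k) Cs → clauseOBDDs vs Cs ⊆ prev →
                Steps pre prev (conjoin vs Cs)
conjoin-steps vs []           _   = []
conjoin-steps vs (C ∷ [])     _   = []
conjoin-steps vs (C ∷ D ∷ Ds) sub =
  Steps-++ (conjoin vs (D ∷ Ds)) (conjoin-steps vs (D ∷ Ds) (sub ∘ there))
    (conj (cnfBDD vs (C ∷ [])) (cnfBDD vs (D ∷ Ds))
          (∈-++⁺ˡ (sub (here refl))) (conjoin-result vs (D ∷ Ds) (λ ()) (sub ∘ there)) split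
     ∷ [])
  where
  split : Represents (cnfBDD vs (C ∷ D ∷ Ds))
                     (λ ρ → eval (cnfBDD vs (C ∷ [])) ρ ∧ eval (cnfBDD vs (D ∷ Ds)) ρ)
  split ρ = trans (eval-cnfBDD vs (C ∷ D ∷ Ds) ρ) (trans (satisfies-++ (C ∷ []) (D ∷ Ds) _)
              (sym (cong₂ _∧_ (eval-cnfBDD vs (C ∷ []) ρ) (eval-cnfBDD vs (D ∷ Ds) ρ))))

conjoin-bounded : ∀ {k n} (vs : Vec Var k) Cs → (∀ Ds → Bounded n (cnfBDD vs Ds)) →
                  AllL.All (Bounded n) (conjoin vs Cs)
conjoin-bounded vs []           _ = []
conjoin-bounded vs (C ∷ [])     _ = []
conjoin-bounded vs (C ∷ D ∷ Ds) b = AllP.++⁺ (conjoin-bounded vs (D ∷ Ds) b) (b (C ∷ D ∷ Ds) ∷ [])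

clauseOBDDs-bounded : ∀ {k n} (vs : Vec Var k) Cs → (∀ Ds → Bounded n (cnfBDD vs Ds)) →
                      AllL.All (Bounded n) (clauseOBDDs vs Cs)
clauseOBDDs-bounded vs Cs b = AllP.map⁺ (AllL.universal (λ C → b (C ∷ [])) Cs)

assignLast : ∀ {k} → Bool → (Bool → Vec Bool (k + 1) → Bool) → Bool → Vec Bool k → Bool
assignLast c g p bs = g p (bs Vec.++ c ∷ [])

projectLast : ∀ {k} → (Bool → Vec Bool (k + 1) → Bool) → Bool → Vec Bool k → Bool
projectLast g p bs = assignLast false g p bs ∨ assignLast true g p bs

assignLast-represents : ∀ {k} m (us : Vec Var k) x g c → Linked _<_ (m ∷ us Vec.++ x ∷ []) →
  Represents (parityBDD m us (assignLast c g)) (λ ρ → eval (parityBDD m (us Vec.++ x ∷ []) g) (ρ [ x ↦ c ]))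
assignLast-represents m us x g c l ρ =
  trans (eval-parityBDD m us (assignLast c g) ρ) (sym (eval-parityBDD-update m us x [] g ρ c l))

projectLast-represents : ∀ {k} m (us : Vec Var k) x g → Linked _<_ (m ∷ us Vec.++ x ∷ []) →
  Represents (parityBDD m us (projectLast g))
             (λ ρ → eval (parityBDD m (us Vec.++ x ∷ []) g) (ρ [ x ↦ false ]) ∨
                    eval (parityBDD m (us Vec.++ x ∷ []) g) (ρ [ x ↦ true ]))
projectLast-represents m us x g l ρ = trans (eval-parityBDD m us (projectLast g) ρ)
  (sym (cong₂ _∨_ (eval-parityBDD-update m us x [] g ρ false l)
                  (eval-parityBDD-update m us x [] g ρ true l)))

length-concat-map : ∀ {A B : Set} (f : A → List B) {c} xs → (∀ x → length (f x) ≡ c) →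
                    length (concat (map f xs)) ≡ length xs * c
length-concat-map f []       _       = refl
length-concat-map f (x ∷ xs) lengths =
  trans (length-++ (f x)) (cong₂ _+_ (lengths x) (length-concat-map f xs lengths))

sum-size : ∀ {b} Ls → AllL.All (λ L → size L ≤ b) Ls → sum (map size Ls) ≤ length Ls * b
sum-size []       []         = z≤n
sum-size (L ∷ Ls) (L≤ ∷ Ls≤) = +-mono-≤ L≤ (sum-size Ls Ls≤)

-- 34n² + 2142n = 17n · (2n + 126): fewer than 17n OBDDs, each of at most 2n + 126 nodes
sizePoly : Poly
sizePoly = 0 ∷ 2142 ∷ 34 ∷ []

module QUParityRefutation (r : ℕ) where

  n : ℕ
  n = 2 + r

  open QUP n

  x<z₁ : ∀ {i} → i ≤ n → xv i < z₁
  x<z₁ i≤n = ≤-<-trans i≤n (m<m+n n (s≤s z≤n))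

  z₁<z₂ : z₁ < z₂
  z₁<z₂ = +-monoʳ-< n (s≤s (s≤s z≤n))

  z₂<t : ∀ {j} → 1 ≤ j → z₂ < tv j
  z₂<t 1≤j = m<m+n (n + 2) 1≤j

  t<t : ∀ j → tv j < tv (suc j)
  t<t j = +-monoʳ-< (n + 2) (n<1+n j)

  n<z₁ : n < z₁
  n<z₁ = x<z₁ ≤-refl

  Invariant : ℕ → Assignment → Bool
  Invariant j ρ = tracks (ρ z₁ xor ρ z₂) (ρ (tv j)) (parity ρ (range 1 j))

  invariantTree : Bool → Vec Bool 3 → Bool
  invariantTree p (y₁ ∷ y₂ ∷ t ∷ []) = tracks (y₁ xor y₂) t p

  invariantBDD : ℕ → OBDD
  invariantBDD j = parityBDD j (z₁ ∷ z₂ ∷ tv j ∷ []) invariantTree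

  InvariantDerived : List OBDD → ℕ → Set
  InvariantDerived prev j = Σ[ A ∈ OBDD ] A ∈ prev × Represents A (Invariant j)

  vars₂ : Vec Var 5
  vars₂ = xv 1 ∷ xv 2 ∷ z₁ ∷ z₂ ∷ tv 2 ∷ []

  -- the clauses of the pair (x₁, x₂, t₂) over the slots of vars₂
  pair₂ : List Clause
  pair₂ = pairClauses 0 1 4 2 3

  linked₂ : Linked _<_ (0 ∷ vars₂)
  linked₂ = s≤s z≤n ∷ n<1+n 1 ∷ x<z₁ (s≤s (s≤s z≤n)) ∷ z₁<z₂ ∷ z₂<t (s≤s z≤n) ∷ [-]

  pair₂-invariant : Represents (cnfBDD vars₂ pair₂) (Invariant 2)
  pair₂-invariant ρ = trans (eval-cnfBDD vars₂ pair₂ ρ)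
    (trans (satisfies-pairClauses (slot (Vec.map ρ vars₂)) 0 1 4 2 3)
           (cong (λ p → tracks (ρ z₁ xor ρ z₂) (ρ (tv 2)) (ρ 1 xor p)) (sym (xor-identityʳ (ρ 2)))))

  blockVars : ℕ → Vec Var 5
  blockVars i = xv i ∷ z₁ ∷ z₂ ∷ tv (i ∸ 1) ∷ tv i ∷ []

  -- the clauses of the pair (tᵢ₋₁, xᵢ, tᵢ) over the slots of blockVars i
  pairᵢ : List Clause
  pairᵢ = pairClauses 3 0 4 1 2

  blockVars-linked : ∀ {m i} → m < i → 2 ≤ i → i ≤ n → Linked _<_ (m ∷ blockVars i)
  blockVars-linked {i = suc (suc k)} m<i (s≤s (s≤s _)) i≤n =
    m<i ∷ x<z₁ i≤n ∷ z₁<z₂ ∷ z₂<t (s≤s z≤n) ∷ t<t (suc k) ∷ [-]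

  joinTree : Bool → Vec Bool 5 → Bool
  joinTree p (x ∷ y₁ ∷ y₂ ∷ t′ ∷ t ∷ []) =
    tracks (y₁ xor y₂) t′ p ∧ satisfies pairᵢ (slot (x ∷ y₁ ∷ y₂ ∷ t′ ∷ t ∷ []))

  joinBDD : ℕ → OBDD
  joinBDD i = parityBDD (i ∸ 1) (blockVars i) joinTree

  blockSteps : ℕ → List OBDD
  blockSteps i = conjoin (blockVars i) pairᵢ ++ joinBDD i ∷ invariantBDD i ∷ []

  project-joinBDD : ∀ j → 1 ≤ j → suc j ≤ n →
    Represents (invariantBDD (suc j))
               (λ ρ → eval (joinBDD (suc j)) (ρ [ tv j ↦ false ]) ∨
                      eval (joinBDD (suc j)) (ρ [ tv j ↦ true ]))
  project-joinBDD j 1≤j i≤n ρ = begin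
    eval (invariantBDD (suc j)) ρ            ≡⟨ eval-parityBDD (suc j) _ invariantTree ρ ⟩
    tracks s t (parity ρ (range 1 (suc j)))  ≡⟨ cong (tracks s t) (parity-range-suc ρ 1 j) ⟩
    tracks s t (p xor x)                     ≡⟨ tracks-∃ s t p x ⟩
    (tracks s false p ∧ tracks s t (false xor x)) ∨ (tracks s true p ∧ tracks s t (true xor x))
                                             ≡⟨ sym (cong₂ _∨_ (assigned false) (assigned true)) ⟩
    eval (joinBDD (suc j)) (ρ [ tv j ↦ false ]) ∨ eval (joinBDD (suc j)) (ρ [ tv j ↦ true ]) ∎
    where
    open ≡-Reasoning
    s = ρ z₁ xor ρ z₂
    t = ρ (tv (suc j))
    p = parity ρ (range 1 j)
    x = ρ (suc j)
    assigned : ∀ b → eval (joinBDD (suc j)) (ρ [ tv j ↦ b ]) ≡ tracks s b p ∧ tracks s t (b xor x)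
    assigned b = trans
      (eval-parityBDD-update j (xv (suc j) ∷ z₁ ∷ z₂ ∷ []) (tv j) (tv (suc j) ∷ []) joinTree ρ b
                             (blockVars-linked (n<1+n j) (s≤s 1≤j) i≤n))
      (cong (tracks s b p ∧_) (satisfies-pairClauses (slot (x ∷ ρ z₁ ∷ ρ z₂ ∷ b ∷ t ∷ [])) 3 0 4 1 2))

  block-steps : ∀ j {prev} → 1 ≤ j → suc j ≤ n → InvariantDerived prev j →
                clauseOBDDs (blockVars (suc j)) pairᵢ ⊆ prev → Steps pre prev (blockSteps (suc j))
  block-steps j 1≤j i≤n (A , A∈ , A-inv) sub =
    Steps-++ (conjoin vs pairᵢ) {joinBDD (suc j) ∷ invariantBDD (suc j) ∷ []} (conjoin-steps vs pairᵢ sub)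
      (conj A (cnfBDD vs pairᵢ) (∈-++⁺ˡ A∈) (conjoin-result vs pairᵢ (λ ()) sub) join ∷
       proj (joinBDD (suc j)) (tv j) new (vars-parityBDD⁺ j vs joinTree (there (there (there (here refl)))))
            (project-joinBDD j 1≤j i≤n) ∷ [])
    where
    vs = blockVars (suc j)
    join : Represents (joinBDD (suc j)) (λ ρ → eval A ρ ∧ eval (cnfBDD vs pairᵢ) ρ)
    join ρ = trans (eval-parityBDD j vs joinTree ρ) (sym (cong₂ _∧_ (A-inv ρ) (eval-cnfBDD vs pairᵢ ρ)))

  block-bounded : ∀ j → 1 ≤ j → suc j ≤ n → AllL.All (Bounded n) (blockSteps (suc j))
  block-bounded j 1≤j i≤n = AllP.++⁺
    (conjoin-bounded (blockVars (suc j)) pairᵢ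
      (λ Ds → cnfBDD-bounded _ Ds ≤-refl (blockVars-linked (s≤s z≤n) (s≤s 1≤j) i≤n)))
    (parityBDD-bounded j _ joinTree (≤-trans (n≤1+n j) i≤n) ≤-refl
                       (blockVars-linked (n<1+n j) (s≤s 1≤j) i≤n) ∷
     parityBDD-bounded (suc j) _ invariantTree i≤n (m≤m+n 3 2) (x<z₁ i≤n ∷ z₁<z₂ ∷ z₂<t (s≤s z≤n) ∷ [-]) ∷
     [])

  blocks : ℕ → ℕ → List OBDD
  blocks j zero    = []
  blocks j (suc k) = blockSteps (suc j) ++ blocks (suc j) k

  next-block : ∀ j k → j + suc k ≤ n → suc j ≤ n × suc j + k ≤ n
  next-block j k j+k≤n = ≤-trans (m≤m+n (suc j) k) i+k≤n , i+k≤n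
    where
    i+k≤n : suc j + k ≤ n
    i+k≤n = subst (_≤ n) (+-suc j k) j+k≤n

  blocks-steps : ∀ k j {prev} → 1 ≤ j → j + k ≤ n → InvariantDerived prev j →
                 (∀ {i} → i ∈ range (suc j) k → clauseOBDDs (blockVars i) pairᵢ ⊆ prev) →
                 Steps pre prev (blocks j k) × InvariantDerived (prev ++ blocks j k) (j + k)
  blocks-steps zero j {prev} _ _ derived _ =
    [] , subst₂ InvariantDerived (sym (++-identityʳ prev)) (sym (+-identityʳ j)) derived
  blocks-steps (suc k) j {prev} 1≤j j+k≤n derived sub with next-block j k j+k≤n
  ... | i≤n , i+k≤n =
    Steps-++ (blockSteps (suc j)) (block-steps j 1≤j i≤n derived (sub (here refl))) (proj₁ rest) ,
    subst₂ InvariantDerived (++-assoc prev (blockSteps (suc j)) _) (sym (+-suc j k)) (proj₂ rest)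
    where
    rest = blocks-steps k (suc j) {prev ++ blockSteps (suc j)} (s≤s z≤n) i+k≤n
             (invariantBDD (suc j) ,
              ∈-++⁺ʳ prev (∈-++⁺ʳ (conjoin (blockVars (suc j)) pairᵢ) (there (here refl))) ,
              eval-parityBDD (suc j) _ invariantTree)
             (λ i∈ C∈ → ∈-++⁺ˡ (sub (there i∈) C∈))

  blocks-bounded : ∀ k j → 1 ≤ j → j + k ≤ n → AllL.All (Bounded n) (blocks j k)
  blocks-bounded zero    j _   _     = []
  blocks-bounded (suc k) j 1≤j j+k≤n with next-block j k j+k≤n
  ... | i≤n , i+k≤n = AllP.++⁺ (block-bounded j 1≤j i≤n) (blocks-bounded k (suc j) (s≤s z≤n) i+k≤n)

  length-blocks : ∀ j k → length (blocks j k) ≡ k * 9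
  length-blocks j zero    = refl
  length-blocks j (suc k) =
    trans (length-++ (blockSteps (suc j)) {blocks (suc j) k}) (cong (9 +_) (length-blocks (suc j) k))

  finalVars : Vec Var 3
  finalVars = z₁ ∷ z₂ ∷ tv n ∷ []

  -- z₁ ∨ z₂ ∨ tₙ and ¬z₁ ∨ ¬z₂ ∨ ¬tₙ over the slots of finalVars
  final⁺ final⁻ : Clause
  final⁺ = pos 0 ∷ pos 1 ∷ pos 2 ∷ []
  final⁻ = neg 0 ∷ neg 1 ∷ neg 2 ∷ []

  closing₁ closing₂ : Bool → Vec Bool 3 → Bool
  closing₁ p bs = invariantTree p bs ∧ satisfies (final⁺ ∷ []) (slot bs)
  closing₂ p bs = closing₁ p bs ∧ satisfies (final⁻ ∷ []) (slot bs)

  bothAssigned : Bool → Bool → Vec Bool 0 → Bool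
  bothAssigned c = assignLast c (assignLast c (projectLast closing₂))

  -- z₁ = z₂ = 0 forces tₙ = 1 and z₁ = z₂ = 1 forces tₙ = 0, while tₙ is the parity in both cases
  bothAssigned-contradictory : ∀ p → bothAssigned false p [] ∧ bothAssigned true p [] ≡ false
  bothAssigned-contradictory false = refl
  bothAssigned-contradictory true  = refl

  closingBDD₁ closingBDD₂ projectedBDD falseBDD : OBDD
  closingBDD₁  = parityBDD n finalVars closing₁
  closingBDD₂  = parityBDD n finalVars closing₂
  projectedBDD = parityBDD n (z₁ ∷ z₂ ∷ []) (projectLast closing₂)
  falseBDD     = parityBDD 0 [] (λ _ _ → false)

  z₂-assigned z₁-assigned : Bool → OBDD
  z₂-assigned c = parityBDD n (z₁ ∷ []) (assignLast c (projectLast closing₂))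
  z₁-assigned c = parityBDD n [] (bothAssigned c)

  finalSteps : List OBDD
  finalSteps = closingBDD₁ ∷ closingBDD₂ ∷ projectedBDD ∷ z₂-assigned false ∷ z₂-assigned true ∷
               z₁-assigned false ∷ z₁-assigned true ∷ falseBDD ∷ []

  xQuantified tQuantified : Prefix
  xQuantified = map (λ i → (∃q , xv i)) from1
  tQuantified = map (λ i → (∃q , tv i)) from2

  x-quantified : ∀ {v} → v ∈ range 1 n → (∃q , v) ∈ xQuantified
  x-quantified {v} v∈ = ∈-map⁺ (λ i → (∃q , xv i)) (subst (v ∈_) (sym (map-upTo-range 1 n)) v∈)

  z₂-rightmost : ∀ g → UnivRightmost pre (parityBDD n (z₁ ∷ z₂ ∷ []) g) z₂
  z₂-rightmost g = xQuantified ++ (∀q , z₁) ∷ [] , tQuantified , sym (++-assoc xQuantified _ _) , earlier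
    where
    earlier : ∀ v → v ∈ vars (parityBDD n (z₁ ∷ z₂ ∷ []) g) →
              v ≡ z₂ ⊎ v ∈ map proj₂ (xQuantified ++ (∀q , z₁) ∷ [])
    earlier v v∈ with vars-parityBDD⁻ n _ g v∈
    ... | inj₁ v∈x                 = inj₂ (∈-map⁺ proj₂ (∈-++⁺ˡ (x-quantified v∈x)))
    ... | inj₂ (here refl)         = inj₂ (∈-map⁺ proj₂ (∈-++⁺ʳ xQuantified (here refl)))
    ... | inj₂ (there (here refl)) = inj₁ refl

  z₁-rightmost : ∀ g → UnivRightmost pre (parityBDD n (z₁ ∷ []) g) z₁
  z₁-rightmost g = xQuantified , (∀q , z₂) ∷ tQuantified , refl , earlier
    where
    earlier : ∀ v → v ∈ vars (parityBDD n (z₁ ∷ []) g) → v ≡ z₁ ⊎ v ∈ map proj₂ xQuantified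
    earlier v v∈ with vars-parityBDD⁻ n _ g v∈
    ... | inj₁ v∈x         = inj₂ (∈-map⁺ proj₂ (x-quantified v∈x))
    ... | inj₂ (here refl) = inj₁ refl

  final-steps : ∀ {prev} → InvariantDerived prev n → clauseOBDDs finalVars (final⁺ ∷ final⁻ ∷ []) ⊆ prev →
                Steps pre prev finalSteps
  final-steps (A , A∈ , A-inv) sub =
    conj A (cnfBDD finalVars (final⁺ ∷ [])) A∈ (sub (here refl)) add⁺ ∷
    conj closingBDD₁ (cnfBDD finalVars (final⁻ ∷ [])) new (old (sub (there (here refl)))) add⁻ ∷
    proj closingBDD₂ (tv n) new (vars-parityBDD⁺ n finalVars closing₂ (there (there (here refl))))
         (projectLast-represents n (z₁ ∷ z₂ ∷ []) (tv n) closing₂ (n<z₁ ∷ z₁<z₂ ∷ z₂<t (s≤s z≤n) ∷ [-])) ∷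
    ured projectedBDD z₂ false new (vars-parityBDD⁺ n _ _ (there (here refl))) (z₂-rightmost _)
         (assign-z₂ false) ∷
    ured projectedBDD z₂ true (old new) (vars-parityBDD⁺ n _ _ (there (here refl))) (z₂-rightmost _)
         (assign-z₂ true) ∷
    ured (z₂-assigned false) z₁ false (old new) (vars-parityBDD⁺ n _ _ (here refl)) (z₁-rightmost _)
         (assign-z₁ false) ∷
    ured (z₂-assigned true) z₁ true (old new) (vars-parityBDD⁺ n _ _ (here refl)) (z₁-rightmost _)
         (assign-z₁ true) ∷
    conj (z₁-assigned false) (z₁-assigned true) (old new) new contradiction ∷ []
    where
    add⁺ : Represents closingBDD₁ (λ ρ → eval A ρ ∧ eval (cnfBDD finalVars (final⁺ ∷ [])) ρ)
    add⁺ ρ = trans (eval-parityBDD n finalVars closing₁ ρ)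
                   (sym (cong₂ _∧_ (A-inv ρ) (eval-cnfBDD finalVars _ ρ)))
    add⁻ : Represents closingBDD₂ (λ ρ → eval closingBDD₁ ρ ∧ eval (cnfBDD finalVars (final⁻ ∷ [])) ρ)
    add⁻ ρ = trans (eval-parityBDD n finalVars closing₂ ρ)
                   (sym (cong₂ _∧_ (eval-parityBDD n finalVars closing₁ ρ) (eval-cnfBDD finalVars _ ρ)))
    assign-z₂ : ∀ c → Represents (z₂-assigned c) (λ ρ → eval projectedBDD (ρ [ z₂ ↦ c ]))
    assign-z₂ c = assignLast-represents n (z₁ ∷ []) z₂ (projectLast closing₂) c (n<z₁ ∷ z₁<z₂ ∷ [-])
    assign-z₁ : ∀ c → Represents (z₁-assigned c) (λ ρ → eval (z₂-assigned c) (ρ [ z₁ ↦ c ]))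
    assign-z₁ c = assignLast-represents n [] z₁ (assignLast c (projectLast closing₂)) c (n<z₁ ∷ [-])
    contradiction : Represents falseBDD (λ ρ → eval (z₁-assigned false) ρ ∧ eval (z₁-assigned true) ρ)
    contradiction ρ = trans (eval-parityBDD 0 [] (λ _ _ → false) ρ) (sym (trans
      (cong₂ _∧_ (eval-parityBDD n [] (bothAssigned false) ρ) (eval-parityBDD n [] (bothAssigned true) ρ))
      (bothAssigned-contradictory (parity ρ (range 1 n)))))

  final-bounded : AllL.All (Bounded n) finalSteps
  final-bounded =
    parityBDD-bounded n finalVars closing₁ ≤-refl (m≤m+n 3 2) linked₃ ∷
    parityBDD-bounded n finalVars closing₂ ≤-refl (m≤m+n 3 2) linked₃ ∷
    parityBDD-bounded n _ _ ≤-refl (m≤m+n 2 3) (n<z₁ ∷ z₁<z₂ ∷ [-]) ∷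
    parityBDD-bounded n _ _ ≤-refl (m≤m+n 1 4) (n<z₁ ∷ [-]) ∷
    parityBDD-bounded n _ _ ≤-refl (m≤m+n 1 4) (n<z₁ ∷ [-]) ∷
    parityBDD-bounded n _ _ ≤-refl z≤n [-] ∷
    parityBDD-bounded n _ _ ≤-refl z≤n [-] ∷
    parityBDD-bounded 0 _ _ z≤n z≤n [-] ∷ []
    where
    linked₃ : Linked _<_ (n ∷ finalVars)
    linked₃ = n<z₁ ∷ z₁<z₂ ∷ z₂<t (s≤s z≤n) ∷ [-]

  blockClauses : List OBDD
  blockClauses = concat (map (λ i → clauseOBDDs (blockVars i) pairᵢ) from3)

  matrixOBDDs : List OBDD
  matrixOBDDs = clauseOBDDs vars₂ pair₂ ++ blockClauses ++ clauseOBDDs finalVars (final⁺ ∷ final⁻ ∷ [])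

  derivationSteps : List OBDD
  derivationSteps = conjoin vars₂ pair₂ ++ blocks 2 r ++ finalSteps

  matrix-represented : Pointwise (λ L C → Represents L (evalClause C)) matrixOBDDs mat
  matrix-represented =
    PW.++⁺ (c ∷ c ∷ c ∷ c ∷ c ∷ c ∷ c ∷ c ∷ [])
      (PW.++⁺ (PW.concat⁺ (PW.map⁺ {xs = from3} {ys = from3}
                 (λ i → clauseOBDDs (blockVars i) pairᵢ)
                 (λ i → pair (pos (tv (i ∸ 1))) (pos (xv i)) (pos (tv i)))
                 (PWP.refl (c ∷ c ∷ c ∷ c ∷ c ∷ c ∷ c ∷ c ∷ []))))
              (c ∷ c ∷ []))
    where
    c : ∀ {k} {vs : Vec Var k} {C} →
        Represents (cnfBDD vs (C ∷ [])) (λ ρ → evalClause C (slot (Vec.map ρ vs)))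
    c {vs = vs} {C} = clause-represents vs C

  block-clauses⊆ : ∀ {i} → i ∈ range 3 r → clauseOBDDs (blockVars i) pairᵢ ⊆ matrixOBDDs
  block-clauses⊆ {i} i∈ C∈ = ∈-++⁺ʳ (clauseOBDDs vars₂ pair₂) (∈-++⁺ˡ (∈-concat⁺′ C∈
    (∈-map⁺ (λ i → clauseOBDDs (blockVars i) pairᵢ) (subst (i ∈_) (sym (map-upTo-range 3 r)) i∈))))

  final-clauses⊆ : clauseOBDDs finalVars (final⁺ ∷ final⁻ ∷ []) ⊆ matrixOBDDs
  final-clauses⊆ C∈ = ∈-++⁺ʳ (clauseOBDDs vars₂ pair₂) (∈-++⁺ʳ blockClauses C∈)

  steps-valid : Steps pre matrixOBDDs derivationSteps
  steps-valid =
    Steps-++ (conjoin vars₂ pair₂) {blocks 2 r ++ finalSteps} (conjoin-steps vars₂ pair₂ ∈-++⁺ˡ)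
      (Steps-++ (blocks 2 r) {finalSteps} (proj₁ iterated)
        (final-steps (proj₂ iterated) (λ C∈ → ∈-++⁺ˡ (∈-++⁺ˡ (final-clauses⊆ C∈)))))
    where
    iterated = blocks-steps r 2 {matrixOBDDs ++ conjoin vars₂ pair₂} (s≤s z≤n) ≤-refl
      (cnfBDD vars₂ pair₂ , conjoin-result vars₂ pair₂ (λ ()) ∈-++⁺ˡ , pair₂-invariant)
      (λ i∈ C∈ → ∈-++⁺ˡ (block-clauses⊆ i∈ C∈))

  block-clauses-bounded : ∀ {i} → i ∈ range 3 r → AllL.All (Bounded n) (clauseOBDDs (blockVars i) pairᵢ)
  block-clauses-bounded i∈ with range-bounds 3 r i∈
  ... | 3≤i , i<3+r = clauseOBDDs-bounded _ pairᵢ (λ Ds → cnfBDD-bounded _ Ds ≤-refl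
          (blockVars-linked (≤-trans (s≤s z≤n) 3≤i) (≤-trans (n≤1+n 2) 3≤i) (≤-pred i<3+r)))

  matrix-bounded : AllL.All (Bounded n) matrixOBDDs
  matrix-bounded =
    AllP.++⁺ (clauseOBDDs-bounded vars₂ pair₂ (λ Ds → cnfBDD-bounded vars₂ Ds ≤-refl linked₂))
      (AllP.++⁺ (AllP.concat⁺ (AllP.map⁺ (AllL.tabulate
                  (λ {i} i∈ → block-clauses-bounded (subst (i ∈_) (map-upTo-range 3 r) i∈)))))
                (clauseOBDDs-bounded finalVars _ (λ Ds → cnfBDD-bounded finalVars Ds (m≤m+n 3 2)
                  (s≤s z≤n ∷ z₁<z₂ ∷ z₂<t (s≤s z≤n) ∷ [-]))))

  steps-bounded : AllL.All (Bounded n) derivationSteps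
  steps-bounded =
    AllP.++⁺ (conjoin-bounded vars₂ pair₂ (λ Ds → cnfBDD-bounded vars₂ Ds ≤-refl linked₂))
      (AllP.++⁺ (blocks-bounded r 2 (s≤s z≤n) ≤-refl) final-bounded)

  all-bounded : AllL.All (Bounded n) (matrixOBDDs ++ derivationSteps)
  all-bounded = AllP.++⁺ matrix-bounded steps-bounded

  length-derivation : length (matrixOBDDs ++ derivationSteps) ≡ 25 + r * 17
  length-derivation = begin
    length (matrixOBDDs ++ derivationSteps)     ≡⟨ length-++ matrixOBDDs ⟩
    length matrixOBDDs + length derivationSteps
                                                ≡⟨ cong₂ (λ a b → 8 + a + (7 + b)) matrix-length steps-length ⟩
    8 + (r * 8 + 2) + (7 + (r * 9 + 8))         ≡⟨ count r ⟩
    25 + r * 17                                 ∎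
    where
    open ≡-Reasoning
    matrix-length : length (blockClauses ++ clauseOBDDs finalVars (final⁺ ∷ final⁻ ∷ [])) ≡ r * 8 + 2
    matrix-length = trans (length-++ blockClauses) (cong (_+ 2)
      (trans (length-concat-map _ from3 (λ _ → refl))
             (cong (_* 8) (trans (length-map _ (upTo r)) (length-upTo r)))))
    steps-length : length (blocks 2 r ++ finalSteps) ≡ r * 9 + 8
    steps-length = trans (length-++ (blocks 2 r)) (cong (_+ 8) (length-blocks 2 r))
    count : ∀ r → 8 + (r * 8 + 2) + (7 + (r * 9 + 8)) ≡ 25 + r * 17
    count = solve 1 (λ r → con 8 :+ (r :* con 8 :+ con 2) :+ (con 7 :+ (r :* con 9 :+ con 8))
                         := con 25 :+ r :* con 17) refl

  refutation : Refutation (QUParity n)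
  refutation = record
    { order       = idOrder
    ; clauseBDDs  = matrixOBDDs
    ; steps       = derivationSteps
    ; clausesRep  = matrix-represented
    ; stepsValid  = steps-valid
    ; allOBDD     = λ L L∈ → Bounded.ordered (AllL.lookup all-bounded L∈)
    ; final       = falseBDD
    ; finalIsLast = last-++ matrixOBDDs derivationSteps
                      (last-++ (conjoin vars₂ pair₂) (blocks 2 r ++ finalSteps)
                        (last-++ (blocks 2 r) finalSteps refl))
    ; finalFalse  = eval-parityBDD 0 [] (λ _ _ → false)
    }

  refutation-size : refSize refutation ≤ evalPoly sizePoly n
  refutation-size = begin
    sum (map size D)  ≤⟨ subst (λ k → sum (map size D) ≤ k * b) length-derivation
                               (sum-size D (AllL.map Bounded.small all-bounded)) ⟩
    (25 + r * 17) * b ≤⟨ *-monoˡ-≤ b (+-monoˡ-≤ (r * 17) (m≤m+n 25 9)) ⟩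
    n * 17 * b        ≡⟨ quadratic n ⟩
    evalPoly sizePoly n ∎
    where
    open ≤-Reasoning
    D = matrixOBDDs ++ derivationSteps
    b = n + n + (treeSize 5 + treeSize 5)
    quadratic : ∀ n → n * 17 * (n + n + 126) ≡ evalPoly sizePoly n
    quadratic = solve 1 (λ n → n :* con 17 :* (n :+ n :+ con 126)
                             := con 0 :+ n :* (con 2142 :+ n :* (con 34 :+ n :* con 0))) refl

corollary3 : Σ[ p ∈ Poly ] ((n : ℕ) → 2 ≤ n →
    Σ[ R ∈ Refutation (QUParity n) ] refSize R ≤ evalPoly p n)
corollary3 = sizePoly , refute
  where
  refute : (n : ℕ) → 2 ≤ n → Σ[ R ∈ Refutation (QUParity n) ] refSize R ≤ evalPoly sizePoly n
  refute 0             ()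
  refute 1             (s≤s ())
  refute (suc (suc r)) _ = refutation , refutation-size
    where open QUParityRefutation r
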